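{- Let $\mathbf{F}$ be a field and let $A=\{0,1,a\}\subseteq\mathbf{F}$ have cardinality $3$ (so $a\neq 0,1$). Let $\mathcal{E}(A)$ be the set of all $c\in\mathbf{F}$ such that the map $(a_1,a_2)\mapsto a_1+ca_2$ is not injective on $A^2$. For $c\neq 0$ let $E(c)=\{c,-c,1/c,-1/c\}$. Then \[ \mathcal{E}(\{0,1,a\})=\{0,\pm1\}\cup E(a)\cup E(a-1)\cup E\!\left(\frac{a-1}{a}\right), \] that is, \[ \mathcal{E}(\{0,1,a\})=\left\{0,\pm1,\pm a,\pm\frac1a,\pm(a-1),\pm\frac{1}{a-1},\pm\frac{a-1}{a},\pm\frac{a}{a-1}\right\}. \]
   Context: Equivalently, $c\in\mathcal{E}(A)$ iff $A$ is not a Sidon set for the form $x_1+cx_2$, where a set $A$ is a Sidon set for a form $\varphi$ in $h$ variables if $\varphi$ is injective on $A^h$. -}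

module Defs where

open import Level using (Level; _⊔_) renaming (suc to lsuc)
open import Algebra.Bundles using (CommutativeRing)
open import Data.Product using (Σ; ∃; _×_; _,_)
open import Data.Sum using (_⊎_)
open import Relation.Nullary using (¬_)

record Field (c ℓ : Level) : Set (lsuc (c ⊔ ℓ)) where
  field
    commutativeRing : CommutativeRing c ℓ
  open CommutativeRing commutativeRing public
  field
    _⁻¹       : Carrier → Carrier
    0≉1       : ¬ (0# ≈ 1#)
    ⁻¹-inverse : ∀ x → ¬ (x ≈ 0#) → x * (x ⁻¹) ≈ 1#

module FieldDefs {c ℓ : Level} (F : Field c ℓ) where
  open Field F

  InA : Carrier → Carrier → Set ℓ
  InA a x = (x ≈ 0#) ⊎ (x ≈ 1#) ⊎ (x ≈ a)

  InExceptional : Carrier → Carrier → Set (c ⊔ ℓ)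
  InExceptional a x =
    Σ Carrier λ a₁ → Σ Carrier λ a₂ → Σ Carrier λ b₁ → Σ Carrier λ b₂ →
      InA a a₁ × InA a a₂ × InA a b₁ × InA a b₂ ×
      ¬ ((a₁ ≈ b₁) × (a₂ ≈ b₂)) ×
      (a₁ + x * a₂ ≈ b₁ + x * b₂)

  InE : Carrier → Carrier → Set ℓ
  InE d x = (x ≈ d) ⊎ (x ≈ - d) ⊎ (x ≈ d ⁻¹) ⊎ (x ≈ - (d ⁻¹))

  InRHS : Carrier → Carrier → Set ℓ
  InRHS a x = (x ≈ 0#) ⊎ (x ≈ 1#) ⊎ (x ≈ - 1#)
            ⊎ InE a x ⊎ InE (a - 1#) x ⊎ InE ((a - 1#) * (a ⁻¹)) x

-- By the defining equation, c ∈ 𝓔(A) exactly when c · (a₂ - b₂) = b₁ - a₁ for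
-- a₁, a₂, b₁, b₂ ∈ A with a₂ ≠ b₂, i.e. when c · u ∈ A - A for some nonzero
-- difference u of A. Up to sign, the nonzero differences of {0, 1, a} are
-- 1, a and a - 1, so 𝓔(A) consists of 0 and the quotients ±v/u of two of
-- them; these are 0, ±1 and the elements of E(a), E(a - 1) and E((a - 1)/a).
module Submission where

open import Defs
open import Level using (Level)
open import Algebra.Bundles using (Ring)
open import Data.Product using (Σ; _×_; _,_; proj₂)
open import Data.Sum using (_⊎_; inj₁; inj₂)
open import Data.Empty using (⊥-elim)
open import Function using (_∘_)
open import Function.Bundles using (_⇔_; mk⇔; Equivalence)
open import Relation.Nullary using (¬_)

module RingProperties {c ℓ : Level} (R : Ring c ℓ) where
  open Ring R
  open import Algebra.Properties.Ring R
  open import Relation.Binary.Reasoning.Setoid setoid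

  x-0≈x : ∀ x → x - 0# ≈ x
  x-0≈x x = trans (+-congˡ -0#≈0#) (+-identityʳ x)

  +-shift : ∀ {p y r z} → p + y ≈ r + z → y - z ≈ r - p
  +-shift {p} {y} {r} {z} eq = begin
    y - z                  ≈⟨ +-congʳ (y≈x\\z p y (r + z) eq) ⟩
    (- p + (r + z)) - z    ≈⟨ +-assoc (- p) (r + z) (- z) ⟩
    - p + ((r + z) - z)    ≈⟨ +-congˡ (//-rightDividesʳ z r) ⟩
    - p + r                ≈⟨ +-comm (- p) r ⟩
    r - p                  ∎

  +-unshift : ∀ {p y r z} → y - z ≈ r - p → p + y ≈ r + z
  +-unshift {p} {y} {r} {z} eq = begin
    p + y                  ≈⟨ +-congˡ (//-rightDividesˡ z y) ⟨
    p + ((y - z) + z)      ≈⟨ +-congˡ (+-congʳ eq) ⟩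
    p + ((r - p) + z)      ≈⟨ +-assoc p (r - p) z ⟨
    (p + (r - p)) + z      ≈⟨ +-congʳ (+-comm p (r - p)) ⟩
    ((r - p) + p) + z      ≈⟨ +-congʳ (//-rightDividesˡ p r) ⟩
    r + z                  ∎

  +-*-shift : ∀ p q r s x → p + x * q ≈ r + x * s ⇔ x * (q - s) ≈ r - p
  +-*-shift p q r s x = mk⇔
    (λ eq → trans (x[y-z]≈xy-xz x q s) (+-shift eq))
    (λ eq → +-unshift (trans (sym (x[y-z]≈xy-xz x q s)) eq))

  infix 4 _≈±_

  _≈±_ : Carrier → Carrier → Set ℓ
  x ≈± y = x ≈ y ⊎ x ≈ - y

  ≈±-sym : ∀ {x y} → x ≈± y → y ≈± x
  ≈±-sym (inj₁ x≈y)  = inj₁ (sym x≈y)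
  ≈±-sym {x} {y} (inj₂ x≈-y) = inj₂ (begin
    y      ≈⟨ -‿involutive y ⟨
    - - y  ≈⟨ -‿cong x≈-y ⟨
    - x    ∎)

  ≈±-trans : ∀ {x y z} → x ≈± y → y ≈± z → x ≈± z
  ≈±-trans (inj₁ x≈y)  (inj₁ y≈z)  = inj₁ (trans x≈y y≈z)
  ≈±-trans (inj₁ x≈y)  (inj₂ y≈-z) = inj₂ (trans x≈y y≈-z)
  ≈±-trans (inj₂ x≈-y) (inj₁ y≈z)  = inj₂ (trans x≈-y (-‿cong y≈z))
  ≈±-trans {z = z} (inj₂ x≈-y) (inj₂ y≈-z) =
    inj₁ (trans x≈-y (trans (-‿cong y≈-z) (-‿involutive z)))

  ≈±0⇒≈0 : ∀ {x} → x ≈± 0# → x ≈ 0#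
  ≈±0⇒≈0 (inj₁ x≈0)  = x≈0
  ≈±0⇒≈0 (inj₂ x≈-0) = trans x≈-0 -0#≈0#

  *-congˡ-≈± : ∀ {x y z} → y ≈± z → x * y ≈± x * z
  *-congˡ-≈± (inj₁ y≈z) = inj₁ (*-congˡ y≈z)
  *-congˡ-≈± {x} {z = z} (inj₂ y≈-z) =
    inj₂ (trans (*-congˡ y≈-z) (sym (-‿distribʳ-* x z)))

  *-congʳ-≈± : ∀ {x y z} → x ≈± y → x * z ≈± y * z
  *-congʳ-≈± (inj₁ x≈y) = inj₁ (*-congʳ x≈y)
  *-congʳ-≈± {y = y} {z} (inj₂ x≈-y) =
    inj₂ (trans (*-congʳ x≈-y) (sym (-‿distribˡ-* y z)))

module FieldProperties {c ℓ : Level} (F : Field c ℓ) where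
  open Field F
  open import Relation.Binary.Reasoning.Setoid setoid

  1≉0 : ¬ 1# ≈ 0#
  1≉0 = 0≉1 ∘ sym

  ⁻¹-inverseˡ : ∀ {x} → ¬ x ≈ 0# → x ⁻¹ * x ≈ 1#
  ⁻¹-inverseˡ {x} x≉0 = trans (*-comm (x ⁻¹) x) (⁻¹-inverse x x≉0)

  x*y≈z⇒x≈z*y⁻¹ : ∀ {x y z} → ¬ y ≈ 0# → x * y ≈ z → x ≈ z * y ⁻¹
  x*y≈z⇒x≈z*y⁻¹ {x} {y} {z} y≉0 xy≈z = begin
    x               ≈⟨ *-identityʳ x ⟨
    x * 1#          ≈⟨ *-congˡ (⁻¹-inverse y y≉0) ⟨
    x * (y * y ⁻¹)  ≈⟨ *-assoc x y (y ⁻¹) ⟨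
    (x * y) * y ⁻¹  ≈⟨ *-congʳ xy≈z ⟩
    z * y ⁻¹        ∎

  x*y≈0⇒x≈0 : ∀ {x y} → ¬ y ≈ 0# → x * y ≈ 0# → x ≈ 0#
  x*y≈0⇒x≈0 {y = y} y≉0 xy≈0 = trans (x*y≈z⇒x≈z*y⁻¹ y≉0 xy≈0) (zeroˡ (y ⁻¹))

  x*y≈1⇒x≈y⁻¹ : ∀ {x y} → ¬ y ≈ 0# → x * y ≈ 1# → x ≈ y ⁻¹
  x*y≈1⇒x≈y⁻¹ {y = y} y≉0 xy≈1 = trans (x*y≈z⇒x≈z*y⁻¹ y≉0 xy≈1) (*-identityˡ (y ⁻¹))

  x*y≈y⇒x≈1 : ∀ {x y} → ¬ y ≈ 0# → x * y ≈ y → x ≈ 1#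
  x*y≈y⇒x≈1 {y = y} y≉0 xy≈y = trans (x*y≈z⇒x≈z*y⁻¹ y≉0 xy≈y) (⁻¹-inverse y y≉0)

module ThreePointSet {c ℓ : Level} (F : Field c ℓ) (a : Field.Carrier F)
  (a≉0 : ¬ Field._≈_ F a (Field.0# F)) (a≉1 : ¬ Field._≈_ F a (Field.1# F)) where
  open Field F
  open FieldDefs F
  open FieldProperties F
  open RingProperties ring
  open import Algebra.Properties.Ring ring
  open import Relation.Binary.Reasoning.Setoid setoid

  data Gap : Set where
    [1] [a] [a-1] : Gap

  ⟦_⟧ : Gap → Carrier
  ⟦ [1] ⟧   = 1#
  ⟦ [a] ⟧   = a
  ⟦ [a-1] ⟧ = a - 1#

  top bottom : Gap → Carrier
  top [1]      = 1#
  top [a]      = a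
  top [a-1]    = a
  bottom [1]   = 0#
  bottom [a]   = 0#
  bottom [a-1] = 1#

  top∈A : ∀ u → InA a (top u)
  top∈A [1]   = inj₂ (inj₁ refl)
  top∈A [a]   = inj₂ (inj₂ refl)
  top∈A [a-1] = inj₂ (inj₂ refl)

  bottom∈A : ∀ u → InA a (bottom u)
  bottom∈A [1]   = inj₁ refl
  bottom∈A [a]   = inj₁ refl
  bottom∈A [a-1] = inj₂ (inj₁ refl)

  top-bottom≈⟦⟧ : ∀ u → top u - bottom u ≈ ⟦ u ⟧
  top-bottom≈⟦⟧ [1]   = x-0≈x 1#
  top-bottom≈⟦⟧ [a]   = x-0≈x a
  top-bottom≈⟦⟧ [a-1] = refl

  top≉bottom : ∀ u → ¬ top u ≈ bottom u
  top≉bottom [1]   = 1≉0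
  top≉bottom [a]   = a≉0
  top≉bottom [a-1] = a≉1

  ⟦⟧≉0 : ∀ u → ¬ ⟦ u ⟧ ≈ 0#
  ⟦⟧≉0 u u≈0 = top≉bottom u (x∙y⁻¹≈ε⇒x≈y _ _ (trans (top-bottom≈⟦⟧ u) u≈0))

  IsSignedGap : Carrier → Set ℓ
  IsSignedGap y = Σ Gap λ u → y ≈± ⟦ u ⟧

  IsDifference : Carrier → Set ℓ
  IsDifference y = y ≈ 0# ⊎ IsSignedGap y

  IsDifferenceQuotient : Carrier → Set ℓ
  IsDifferenceQuotient x = Σ Gap λ u → IsDifference (x * ⟦ u ⟧)

  difference-isDifference : ∀ {p q} → InA a p → InA a q → IsDifference (p - q)
  difference-isDifference (inj₁ p≈0) (inj₁ q≈0) = inj₁ (x≈y⇒x∙y⁻¹≈ε (trans p≈0 (sym q≈0)))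
  difference-isDifference (inj₁ p≈0) (inj₂ (inj₁ q≈1)) =
    inj₂ ([1] , inj₂ (trans (//-cong₂ p≈0 q≈1) (+-identityˡ (- 1#))))
  difference-isDifference (inj₁ p≈0) (inj₂ (inj₂ q≈a)) =
    inj₂ ([a] , inj₂ (trans (//-cong₂ p≈0 q≈a) (+-identityˡ (- a))))
  difference-isDifference (inj₂ (inj₁ p≈1)) (inj₁ q≈0) =
    inj₂ ([1] , inj₁ (trans (//-cong₂ p≈1 q≈0) (x-0≈x 1#)))
  difference-isDifference (inj₂ (inj₁ p≈1)) (inj₂ (inj₁ q≈1)) =
    inj₁ (x≈y⇒x∙y⁻¹≈ε (trans p≈1 (sym q≈1)))
  difference-isDifference (inj₂ (inj₁ p≈1)) (inj₂ (inj₂ q≈a)) =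
    inj₂ ([a-1] , inj₂ (trans (//-cong₂ p≈1 q≈a) (sym (⁻¹-anti-homo‿- a 1#))))
  difference-isDifference (inj₂ (inj₂ p≈a)) (inj₁ q≈0) =
    inj₂ ([a] , inj₁ (trans (//-cong₂ p≈a q≈0) (x-0≈x a)))
  difference-isDifference (inj₂ (inj₂ p≈a)) (inj₂ (inj₁ q≈1)) =
    inj₂ ([a-1] , inj₁ (//-cong₂ p≈a q≈1))
  difference-isDifference (inj₂ (inj₂ p≈a)) (inj₂ (inj₂ q≈a)) =
    inj₁ (x≈y⇒x∙y⁻¹≈ε (trans p≈a (sym q≈a)))

  isDifference⇒difference : ∀ {y} → IsDifference y →
    Σ Carrier λ r → Σ Carrier λ p → InA a r × InA a p × y ≈ r - p
  isDifference⇒difference (inj₁ y≈0) =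
    0# , 0# , inj₁ refl , inj₁ refl , trans y≈0 (sym (-‿inverseʳ 0#))
  isDifference⇒difference (inj₂ (v , inj₁ y≈v)) =
    top v , bottom v , top∈A v , bottom∈A v , trans y≈v (sym (top-bottom≈⟦⟧ v))
  isDifference⇒difference (inj₂ (v , inj₂ y≈-v)) =
    bottom v , top v , bottom∈A v , top∈A v ,
    trans y≈-v (trans (-‿cong (sym (top-bottom≈⟦⟧ v))) (⁻¹-anti-homo‿- (top v) (bottom v)))

  isDifference-resp-≈± : ∀ {y z} → y ≈± z → IsDifference z → IsDifference y
  isDifference-resp-≈± y≈±z (inj₁ z≈0)       = inj₁ (≈±0⇒≈0 (≈±-trans y≈±z (inj₁ z≈0)))
  isDifference-resp-≈± y≈±z (inj₂ (v , z≈±v)) = inj₂ (v , ≈±-trans y≈±z z≈±v)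

  exceptional⇒differenceQuotient : ∀ {x} → InExceptional a x → IsDifferenceQuotient x
  exceptional⇒differenceQuotient {x} (p , q , r , s , p∈A , q∈A , r∈A , s∈A , distinct , eq)
    with difference-isDifference q∈A s∈A
  ... | inj₁ q-s≈0 = ⊥-elim (distinct (sym r≈p , q≈s))
    where
    q≈s : q ≈ s
    q≈s = x∙y⁻¹≈ε⇒x≈y q s q-s≈0
    r≈p : r ≈ p
    r≈p = x∙y⁻¹≈ε⇒x≈y r p (begin
      r - p        ≈⟨ Equivalence.to (+-*-shift p q r s x) eq ⟨
      x * (q - s)  ≈⟨ *-congˡ q-s≈0 ⟩
      x * 0#       ≈⟨ zeroʳ x ⟩
      0#           ∎)
  ... | inj₂ (u , q-s≈±u) = u , isDifference-resp-≈± xu≈±r-p (difference-isDifference r∈A p∈A)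
    where
    xu≈±r-p : x * ⟦ u ⟧ ≈± r - p
    xu≈±r-p = ≈±-trans (*-congˡ-≈± (≈±-sym q-s≈±u))
                       (inj₁ (Equivalence.to (+-*-shift p q r s x) eq))

  differenceQuotient⇒exceptional : ∀ {x} → IsDifferenceQuotient x → InExceptional a x
  differenceQuotient⇒exceptional {x} (u , xu∈A-A) with isDifference⇒difference xu∈A-A
  ... | r , p , r∈A , p∈A , xu≈r-p =
    p , top u , r , bottom u , p∈A , top∈A u , r∈A , bottom∈A u ,
    (top≉bottom u ∘ proj₂) ,
    Equivalence.from (+-*-shift p (top u) r (bottom u) x)
      (trans (*-congˡ (top-bottom≈⟦⟧ u)) xu≈r-p)

  a-1/a : Carrier
  a-1/a = (a - 1#) * a ⁻¹

  a-1/a*a≈a-1 : a-1/a * a ≈ a - 1#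
  a-1/a*a≈a-1 = begin
    ((a - 1#) * a ⁻¹) * a  ≈⟨ *-assoc (a - 1#) (a ⁻¹) a ⟩
    (a - 1#) * (a ⁻¹ * a)  ≈⟨ *-congˡ (⁻¹-inverseˡ a≉0) ⟩
    (a - 1#) * 1#          ≈⟨ *-identityʳ (a - 1#) ⟩
    a - 1#                 ∎

  a-1/a≉0 : ¬ a-1/a ≈ 0#
  a-1/a≉0 a-1/a≈0 = ⟦⟧≉0 [a-1] (begin
    a - 1#       ≈⟨ a-1/a*a≈a-1 ⟨
    a-1/a * a    ≈⟨ *-congʳ a-1/a≈0 ⟩
    0# * a       ≈⟨ zeroˡ a ⟩
    0#           ∎)

  a-1/a⁻¹*[a-1]≈a : a-1/a ⁻¹ * (a - 1#) ≈ a
  a-1/a⁻¹*[a-1]≈a = begin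
    a-1/a ⁻¹ * (a - 1#)        ≈⟨ *-congˡ a-1/a*a≈a-1 ⟨
    a-1/a ⁻¹ * (a-1/a * a)     ≈⟨ *-assoc (a-1/a ⁻¹) a-1/a a ⟨
    (a-1/a ⁻¹ * a-1/a) * a     ≈⟨ *-congʳ (⁻¹-inverseˡ a-1/a≉0) ⟩
    1# * a                     ≈⟨ *-identityˡ a ⟩
    a                          ∎

  InE-from-≈± : ∀ {d x} → x ≈± d ⊎ x ≈± d ⁻¹ → InE d x
  InE-from-≈± (inj₁ (inj₁ x≈d))    = inj₁ x≈d
  InE-from-≈± (inj₁ (inj₂ x≈-d))   = inj₂ (inj₁ x≈-d)
  InE-from-≈± (inj₂ (inj₁ x≈d⁻¹))  = inj₂ (inj₂ (inj₁ x≈d⁻¹))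
  InE-from-≈± (inj₂ (inj₂ x≈-d⁻¹)) = inj₂ (inj₂ (inj₂ x≈-d⁻¹))

  InE-to-≈± : ∀ {d x} → InE d x → x ≈± d ⊎ x ≈± d ⁻¹
  InE-to-≈± (inj₁ x≈d)                   = inj₁ (inj₁ x≈d)
  InE-to-≈± (inj₂ (inj₁ x≈-d))           = inj₁ (inj₂ x≈-d)
  InE-to-≈± (inj₂ (inj₂ (inj₁ x≈d⁻¹)))   = inj₂ (inj₁ x≈d⁻¹)
  InE-to-≈± (inj₂ (inj₂ (inj₂ x≈-d⁻¹)))  = inj₂ (inj₂ x≈-d⁻¹)

  InE-resp-≈± : ∀ {d x y} → x ≈± y → InE d y → InE d x
  InE-resp-≈± x≈±y y∈E with InE-to-≈± y∈E
  ... | inj₁ y≈±d   = InE-from-≈± (inj₁ (≈±-trans x≈±y y≈±d))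
  ... | inj₂ y≈±d⁻¹ = InE-from-≈± (inj₂ (≈±-trans x≈±y y≈±d⁻¹))

  ±1∈RHS : ∀ {x} → x ≈± 1# → InRHS a x
  ±1∈RHS (inj₁ x≈1)  = inj₂ (inj₁ x≈1)
  ±1∈RHS (inj₂ x≈-1) = inj₂ (inj₂ (inj₁ x≈-1))

  E[a]⊆RHS : ∀ {x} → InE a x → InRHS a x
  E[a]⊆RHS = inj₂ ∘ inj₂ ∘ inj₂ ∘ inj₁

  E[a-1]⊆RHS : ∀ {x} → InE (a - 1#) x → InRHS a x
  E[a-1]⊆RHS = inj₂ ∘ inj₂ ∘ inj₂ ∘ inj₂ ∘ inj₁

  E[a-1/a]⊆RHS : ∀ {x} → InE a-1/a x → InRHS a x
  E[a-1/a]⊆RHS = inj₂ ∘ inj₂ ∘ inj₂ ∘ inj₂ ∘ inj₂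

  InRHS-resp-≈± : ∀ {x y} → x ≈± y → InRHS a y → InRHS a x
  InRHS-resp-≈± x≈±y (inj₁ y≈0) = inj₁ (≈±0⇒≈0 (≈±-trans x≈±y (inj₁ y≈0)))
  InRHS-resp-≈± x≈±y (inj₂ (inj₁ y≈1)) = ±1∈RHS (≈±-trans x≈±y (inj₁ y≈1))
  InRHS-resp-≈± x≈±y (inj₂ (inj₂ (inj₁ y≈-1))) = ±1∈RHS (≈±-trans x≈±y (inj₂ y≈-1))
  InRHS-resp-≈± x≈±y (inj₂ (inj₂ (inj₂ (inj₁ y∈E)))) = E[a]⊆RHS (InE-resp-≈± x≈±y y∈E)
  InRHS-resp-≈± x≈±y (inj₂ (inj₂ (inj₂ (inj₂ (inj₁ y∈E))))) = E[a-1]⊆RHS (InE-resp-≈± x≈±y y∈E)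
  InRHS-resp-≈± x≈±y (inj₂ (inj₂ (inj₂ (inj₂ (inj₂ y∈E))))) = E[a-1/a]⊆RHS (InE-resp-≈± x≈±y y∈E)

  gap∈RHS : ∀ {x} v → x ≈ ⟦ v ⟧ → InRHS a x
  gap∈RHS [1]   x≈1   = ±1∈RHS (inj₁ x≈1)
  gap∈RHS [a]   x≈a   = E[a]⊆RHS (inj₁ x≈a)
  gap∈RHS [a-1] x≈a-1 = E[a-1]⊆RHS (inj₁ x≈a-1)

  gapRatio∈RHS : ∀ {x} u v → x * ⟦ u ⟧ ≈ ⟦ v ⟧ → InRHS a x
  gapRatio∈RHS {x} [1] v x*1≈v = gap∈RHS v (trans (sym (*-identityʳ x)) x*1≈v)
  gapRatio∈RHS [a] [1] xa≈1 = E[a]⊆RHS (InE-from-≈± (inj₂ (inj₁ (x*y≈1⇒x≈y⁻¹ a≉0 xa≈1))))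
  gapRatio∈RHS [a] [a] xa≈a = ±1∈RHS (inj₁ (x*y≈y⇒x≈1 a≉0 xa≈a))
  gapRatio∈RHS [a] [a-1] xa≈a-1 = E[a-1/a]⊆RHS (inj₁ (x*y≈z⇒x≈z*y⁻¹ a≉0 xa≈a-1))
  gapRatio∈RHS [a-1] [1] x[a-1]≈1 =
    E[a-1]⊆RHS (InE-from-≈± (inj₂ (inj₁ (x*y≈1⇒x≈y⁻¹ (⟦⟧≉0 [a-1]) x[a-1]≈1))))
  gapRatio∈RHS {x} [a-1] [a] x[a-1]≈a =
    E[a-1/a]⊆RHS (InE-from-≈± (inj₂ (inj₁ (x*y≈1⇒x≈y⁻¹ a-1/a≉0 x*a-1/a≈1))))
    where
    x*a-1/a≈1 : x * a-1/a ≈ 1#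
    x*a-1/a≈1 = begin
      x * ((a - 1#) * a ⁻¹)  ≈⟨ *-assoc x (a - 1#) (a ⁻¹) ⟨
      (x * (a - 1#)) * a ⁻¹  ≈⟨ *-congʳ x[a-1]≈a ⟩
      a * a ⁻¹               ≈⟨ ⁻¹-inverse a a≉0 ⟩
      1#                     ∎
  gapRatio∈RHS [a-1] [a-1] x[a-1]≈a-1 = ±1∈RHS (inj₁ (x*y≈y⇒x≈1 (⟦⟧≉0 [a-1]) x[a-1]≈a-1))

  differenceQuotient⇒RHS : ∀ {x} → IsDifferenceQuotient x → InRHS a x
  differenceQuotient⇒RHS (u , inj₁ xu≈0) = inj₁ (x*y≈0⇒x≈0 (⟦⟧≉0 u) xu≈0)
  differenceQuotient⇒RHS (u , inj₂ (v , inj₁ xu≈v)) = gapRatio∈RHS u v xu≈v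
  differenceQuotient⇒RHS {x} (u , inj₂ (v , inj₂ xu≈-v)) =
    InRHS-resp-≈± (inj₂ (sym (-‿involutive x))) (gapRatio∈RHS u v -x*u≈v)
    where
    -x*u≈v : - x * ⟦ u ⟧ ≈ ⟦ v ⟧
    -x*u≈v = begin
      - x * ⟦ u ⟧      ≈⟨ -‿distribˡ-* x ⟦ u ⟧ ⟨
      - (x * ⟦ u ⟧)    ≈⟨ -‿cong xu≈-v ⟩
      - - ⟦ v ⟧        ≈⟨ -‿involutive ⟦ v ⟧ ⟩
      ⟦ v ⟧            ∎

  InE-differenceQuotient : ∀ {d x} u v → d * ⟦ u ⟧ ≈ ⟦ v ⟧ → d ⁻¹ * ⟦ v ⟧ ≈ ⟦ u ⟧ →
    InE d x → IsDifferenceQuotient x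
  InE-differenceQuotient u v du≈v d⁻¹v≈u x∈E with InE-to-≈± x∈E
  ... | inj₁ x≈±d   = u , inj₂ (v , ≈±-trans (*-congʳ-≈± x≈±d) (inj₁ du≈v))
  ... | inj₂ x≈±d⁻¹ = v , inj₂ (u , ≈±-trans (*-congʳ-≈± x≈±d⁻¹) (inj₁ d⁻¹v≈u))

  RHS⇒differenceQuotient : ∀ {x} → InRHS a x → IsDifferenceQuotient x
  RHS⇒differenceQuotient {x} (inj₁ x≈0) = [1] , inj₁ (trans (*-identityʳ x) x≈0)
  RHS⇒differenceQuotient {x} (inj₂ (inj₁ x≈1)) =
    [1] , inj₂ ([1] , inj₁ (trans (*-identityʳ x) x≈1))
  RHS⇒differenceQuotient {x} (inj₂ (inj₂ (inj₁ x≈-1))) =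
    [1] , inj₂ ([1] , inj₂ (trans (*-identityʳ x) x≈-1))
  RHS⇒differenceQuotient (inj₂ (inj₂ (inj₂ (inj₁ x∈E)))) =
    InE-differenceQuotient [1] [a] (*-identityʳ a) (⁻¹-inverseˡ a≉0) x∈E
  RHS⇒differenceQuotient (inj₂ (inj₂ (inj₂ (inj₂ (inj₁ x∈E))))) =
    InE-differenceQuotient [1] [a-1] (*-identityʳ (a - 1#)) (⁻¹-inverseˡ (⟦⟧≉0 [a-1])) x∈E
  RHS⇒differenceQuotient (inj₂ (inj₂ (inj₂ (inj₂ (inj₂ x∈E))))) =
    InE-differenceQuotient [a] [a-1] a-1/a*a≈a-1 a-1/a⁻¹*[a-1]≈a x∈E

mainTheorem6 : {c ℓ : Level} (F : Field c ℓ) (a : Field.Carrier F) →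
    ¬ (Field._≈_ F a (Field.0# F)) → ¬ (Field._≈_ F a (Field.1# F)) →
    (x : Field.Carrier F) →
    FieldDefs.InExceptional F a x ⇔ FieldDefs.InRHS F a x
mainTheorem6 F a a≉0 a≉1 x = mk⇔
  (differenceQuotient⇒RHS ∘ exceptional⇒differenceQuotient)
  (differenceQuotient⇒exceptional ∘ RHS⇒differenceQuotient)
  where open ThreePointSet F a a≉0 a≉1
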